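{- For $j\geq0$, \[\nu_2\bigl(B^{\pm}(j)\bigr)=\begin{cases}0&\text{if } j\equiv0\text{ or }1\pmod 3,\\ 1&\text{if } j\equiv5\text{ or }8\pmod{12},\\ 2&\text{if } j\equiv 11\pmod{12}.\end{cases}\]
   Context: $B^{\pm}(n)=\sum_{k=0}^n(-1)^kS(n,k)$ with $S(n,k)$ the Stirling numbers of the second kind; $\nu_2$ is the $2$-adic valuation. -}

module Defs where

open import Data.Nat as ℕ using (ℕ; zero; suc)
open import Data.Integer as ℤ using (ℤ; +_; -_)
open import Data.Integer.Divisibility using (_∣_)
open import Data.Product using (_×_)
open import Relation.Nullary using (¬_)

S : ℕ → ℕ → ℕ
S zero    zero    = 1
S zero    (suc k) = 0
S (suc n) zero    = 0
S (suc n) (suc k) = suc k ℕ.* S n (suc k) ℕ.+ S n k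

sgn : ℕ → ℤ
sgn zero    = + 1
sgn (suc k) = - sgn k

partialB : ℕ → ℕ → ℤ
partialB n zero    = sgn 0 ℤ.* (+ S n 0)
partialB n (suc m) = partialB n m ℤ.+ sgn (suc m) ℤ.* (+ S n (suc m))

Bpm : ℕ → ℤ
Bpm n = partialB n n

ν₂≡ : ℤ → ℕ → Set
ν₂≡ x e = (+ (2 ℕ.^ e) ∣ x) × ¬ (+ (2 ℕ.^ suc e) ∣ x)

-- Summing the Stirling recurrence against a weight w gives
--   Σₖ S(n+1,k) w(k) = Σₖ S(n,k) (D w)(k),   (D w)(k) = w(k+1) + k w(k),
-- so B^±(j) = (Dʲ sgn)(0). Modulo 8 every Dʲ sgn is 8-periodic, hence determined by
-- a vector of 8 residues on which D acts as an explicit map. Starting from the signs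
-- (1,7,1,7,…) this map has period 24, so B^±(j) mod 8 depends only on j mod 24, and
-- mod 8 determines ν₂ as long as it is at most 2: the 24 cases are checked by evaluation.
module Submission where

open import Defs
open import Data.Nat as ℕ using (ℕ; _%_; zero; suc; NonZero; _<_; _^_)
open import Data.Nat.Properties
  using (+-comm; +-assoc; +-identityʳ; *-zeroʳ; ≤-refl; m≤n⇒m≤1+n; allUpTo?)
import Data.Nat.DivMod as DivMod
open import Data.Nat.DivMod
  using (_/_; m≡m%n+[m/n]*n; m%n<n; m%n%n≡m%n; %-distribˡ-+; m∣n⇒o%n%m≡o%m)
open import Data.Nat.Divisibility as ℕ∣ using (divides; n∣m*n; _∣?_)
open import Data.Nat.GeneralisedArithmetic using (iterate)
open import Data.Integer using (ℤ; +_; -_; _+_; _*_; _-_)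
open import Data.Integer.Properties using (pos-+; pos-*; neg-involutive; *-identityʳ)
import Data.Integer.Divisibility as ℤ∣
open import Data.Integer.Divisibility.Signed as ℤ∣ˢ using (_∣_)
open import Data.Integer.Tactic.RingSolver using (solve-∀)
open import Data.Fin using (toℕ)
open import Data.Fin.Properties using (toℕ-fromℕ<; toℕ-injective)
open import Data.Vec using (Vec; _∷_; []; lookup; tabulate)
open import Data.Vec.Properties using (lookup∘tabulate; ≡-dec)
open import Data.Product using (_×_; _,_)
open import Data.Sum using (_⊎_)
open import Relation.Binary.Bundles using (Setoid)
open import Relation.Binary.Structures using (IsEquivalence)
open import Relation.Nullary using (Dec; ¬?)
open import Relation.Nullary.Decidable using (map′; toWitness; _→-dec_; _×-dec_; _⊎-dec_)
open import Relation.Binary.PropositionalEquality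
  using (_≡_; refl; sym; trans; cong; cong₂; subst; subst₂; module ≡-Reasoning)

infix 4 _≡_mod_

record _≡_mod_ (x y : ℤ) (m : ℕ) : Set where
  constructor mod-intro
  field divides-difference : + m ∣ x - y

open _≡_mod_

module _ {m : ℕ} where

  ≡⇒≡-mod : ∀ {x y} → x ≡ y → x ≡ y mod m
  ≡⇒≡-mod {x} refl = mod-intro (subst (+ m ∣_) (x-x≡0 x) (ℤ∣ˢ.divides (+ 0) refl))
    where
    x-x≡0 : ∀ x → + 0 ≡ x - x
    x-x≡0 = solve-∀

  ≡-mod-sym : ∀ {x y} → x ≡ y mod m → y ≡ x mod m
  ≡-mod-sym {x} {y} (mod-intro m∣x-y) =
    mod-intro (subst (+ m ∣_) (-[x-y]≡y-x x y) (ℤ∣ˢ.∣m⇒∣-m m∣x-y))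
    where
    -[x-y]≡y-x : ∀ x y → - (x - y) ≡ y - x
    -[x-y]≡y-x = solve-∀

  ≡-mod-trans : ∀ {x y z} → x ≡ y mod m → y ≡ z mod m → x ≡ z mod m
  ≡-mod-trans {x} {y} {z} (mod-intro m∣x-y) (mod-intro m∣y-z) =
    mod-intro (subst (+ m ∣_) (telescope x y z) (ℤ∣ˢ.∣m∣n⇒∣m+n m∣x-y m∣y-z))
    where
    telescope : ∀ x y z → (x - y) + (y - z) ≡ x - z
    telescope = solve-∀

  +-cong-≡-mod : ∀ {x x′ y y′} → x ≡ x′ mod m → y ≡ y′ mod m → x + y ≡ x′ + y′ mod m
  +-cong-≡-mod {x} {x′} {y} {y′} (mod-intro m∣x-x′) (mod-intro m∣y-y′) =
    mod-intro (subst (+ m ∣_) (regroup x x′ y y′) (ℤ∣ˢ.∣m∣n⇒∣m+n m∣x-x′ m∣y-y′))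
    where
    regroup : ∀ x x′ y y′ → (x - x′) + (y - y′) ≡ (x + y) - (x′ + y′)
    regroup = solve-∀

  *-cong-≡-mod : ∀ {x x′ y y′} → x ≡ x′ mod m → y ≡ y′ mod m → x * y ≡ x′ * y′ mod m
  *-cong-≡-mod {x} {x′} {y} {y′} (mod-intro m∣x-x′) (mod-intro m∣y-y′) =
    mod-intro (subst (+ m ∣_) (regroup x x′ y y′)
      (ℤ∣ˢ.∣m∣n⇒∣m+n (ℤ∣ˢ.∣n⇒∣m*n x m∣y-y′) (ℤ∣ˢ.∣m⇒∣m*n y′ m∣x-x′)))
    where
    regroup : ∀ x x′ y y′ → x * (y - y′) + (x - x′) * y′ ≡ x * y - x′ * y′
    regroup = solve-∀

  ≡-mod-isEquivalence : IsEquivalence (λ x y → x ≡ y mod m)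
  ≡-mod-isEquivalence = record
    { refl = ≡⇒≡-mod refl ; sym = ≡-mod-sym ; trans = ≡-mod-trans }

  ∣-resp-≡-mod : ∀ {d x y} → d ℕ∣.∣ m → x ≡ y mod m → + d ℤ∣.∣ x → + d ℤ∣.∣ y
  ∣-resp-≡-mod {d} {x} {y} d∣m (mod-intro m∣x-y) d∣x = ℤ∣ˢ.∣⇒∣ᵤ
    (subst (+ d ∣_) (x-[x-y]≡y x y)
      (ℤ∣ˢ.∣m∣n⇒∣m-n {+ d} {x} (ℤ∣ˢ.∣ᵤ⇒∣ d∣x) (ℤ∣ˢ.∣-trans (ℤ∣ˢ.∣ᵤ⇒∣ d∣m) m∣x-y)))
    where
    x-[x-y]≡y : ∀ x y → x - (x - y) ≡ y
    x-[x-y]≡y = solve-∀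

  ν₂≡-resp-≡-mod : ∀ {e x y} → 2 ^ suc e ℕ∣.∣ m → x ≡ y mod m → ν₂≡ x e → ν₂≡ y e
  ν₂≡-resp-≡-mod 2^[1+e]∣m x≡y (2^e∣x , 2^[1+e]∤x) =
    ∣-resp-≡-mod (ℕ∣.∣-trans (n∣m*n 2) 2^[1+e]∣m) x≡y 2^e∣x ,
    λ 2^[1+e]∣y → 2^[1+e]∤x (∣-resp-≡-mod 2^[1+e]∣m (≡-mod-sym x≡y) 2^[1+e]∣y)

infix 4 _≟_mod_

_≟_mod_ : ∀ x y m → Dec (x ≡ y mod m)
x ≟ y mod m = map′ mod-intro divides-difference (+ m ℤ∣ˢ.∣? (x - y))

≡-mod-setoid : ℕ → Setoid _ _
≡-mod-setoid m = record { isEquivalence = ≡-mod-isEquivalence {m} }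

%-≡-mod : ∀ k m .{{_ : NonZero m}} → + (k % m) ≡ + k mod m
%-≡-mod k m = mod-intro (subst (+ m ∣_) (sym (cancel (+ k) (+ (k % m)) (+ (k / m)) k≡r+qm))
  (ℤ∣ˢ.∣m⇒∣-m (ℤ∣ˢ.divides (+ (k / m)) refl)))
  where
  cancel : ∀ k r q → k ≡ r + q * + m → r - k ≡ - (q * + m)
  cancel _ r q refl = r-[r+s]≡-s r (q * + m)
    where
    r-[r+s]≡-s : ∀ r s → r - (r + s) ≡ - s
    r-[r+s]≡-s = solve-∀
  k≡r+qm : + k ≡ + (k % m) + + (k / m) * + m
  k≡r+qm = trans (cong +_ (m≡m%n+[m/n]*n k m))
    (trans (pos-+ (k % m) (k / m ℕ.* m)) (cong (λ t → + (k % m) + t) (pos-* (k / m) m)))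

stirlingSum : ℕ → ℕ → (ℕ → ℤ) → ℤ
stirlingSum n zero    w = w 0 * + S n 0
stirlingSum n (suc m) w = stirlingSum n m w + w (suc m) * + S n (suc m)

partialB≡stirlingSum : ∀ n m → partialB n m ≡ stirlingSum n m sgn
partialB≡stirlingSum n zero    = refl
partialB≡stirlingSum n (suc m) = cong (_+ sgn (suc m) * + S n (suc m)) (partialB≡stirlingSum n m)

n<k⇒S≡0 : ∀ {n k} → n < k → S n k ≡ 0
n<k⇒S≡0 {zero}  {suc k} _ = refl
n<k⇒S≡0 {suc n} {suc k} (ℕ.s≤s n<k)
  rewrite n<k⇒S≡0 (m≤n⇒m≤1+n n<k) | n<k⇒S≡0 n<k = trans (+-identityʳ (k ℕ.* 0)) (*-zeroʳ k)

D : (ℕ → ℤ) → ℕ → ℤ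
D w k = w (suc k) + + k * w k

S-suc-suc : ∀ n k → + S (suc n) (suc k) ≡ + suc k * + S n (suc k) + + S n k
S-suc-suc n k = trans (pos-+ (suc k ℕ.* S n (suc k)) (S n k))
                      (cong (_+ + S n k) (pos-* (suc k) (S n (suc k))))

stirlingSum-suc : ∀ n m w →
  stirlingSum (suc n) (suc m) w ≡ stirlingSum n m (D w) + + suc m * + S n (suc m) * w (suc m)
stirlingSum-suc n zero w = trans (cong (λ s → w 0 * + 0 + w 1 * s) (S-suc-suc n 0))
                                 (regroup (w 0) (w 1) (+ S n 1) (+ S n 0))
  where
  regroup : ∀ w₀ w₁ s₁ s₀ → w₀ * + 0 + w₁ * (+ 1 * s₁ + s₀) ≡ (w₁ + + 0 * w₀) * s₀ + + 1 * s₁ * w₁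
  regroup = solve-∀
stirlingSum-suc n (suc m) w = begin
  stirlingSum (suc n) (suc m) w + w (2 ℕ.+ m) * + S (suc n) (2 ℕ.+ m)
    ≡⟨ cong₂ (λ a b → a + w (2 ℕ.+ m) * b) (stirlingSum-suc n m w) (S-suc-suc n (suc m)) ⟩
  stirlingSum n m (D w) + + suc m * + S n (suc m) * w (suc m)
    + w (2 ℕ.+ m) * (+ (2 ℕ.+ m) * + S n (2 ℕ.+ m) + + S n (suc m))
    ≡⟨ regroup (stirlingSum n m (D w)) (+ suc m) (+ S n (suc m)) (w (suc m)) (w (2 ℕ.+ m))
               (+ (2 ℕ.+ m)) (+ S n (2 ℕ.+ m)) ⟩
  stirlingSum n (suc m) (D w) + + (2 ℕ.+ m) * + S n (2 ℕ.+ m) * w (2 ℕ.+ m) ∎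
  where
  open ≡-Reasoning
  regroup : ∀ σ a s₁ w₁ w₂ b s₂ →
    σ + a * s₁ * w₁ + w₂ * (b * s₂ + s₁) ≡ σ + (w₂ + a * w₁) * s₁ + b * s₂ * w₂
  regroup = solve-∀

stirlingSum-diagonal : ∀ n w → stirlingSum n n w ≡ iterate D w n 0
stirlingSum-diagonal zero    w = *-identityʳ (w 0)
stirlingSum-diagonal (suc n) w = begin
  stirlingSum (suc n) (suc n) w
    ≡⟨ stirlingSum-suc n n w ⟩
  stirlingSum n n (D w) + + suc n * + S n (suc n) * w (suc n)
    ≡⟨ cong (λ s → stirlingSum n n (D w) + + suc n * + s * w (suc n)) (n<k⇒S≡0 {n} ≤-refl) ⟩
  stirlingSum n n (D w) + + suc n * + 0 * w (suc n)
    ≡⟨ drop-zero (stirlingSum n n (D w)) (+ suc n) (w (suc n)) ⟩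
  stirlingSum n n (D w)
    ≡⟨ stirlingSum-diagonal n (D w) ⟩
  iterate D (D w) n 0 ∎
  where
  open ≡-Reasoning
  drop-zero : ∀ σ a x → σ + a * + 0 * x ≡ σ
  drop-zero = solve-∀

Bpm≡iterate-D : ∀ n → Bpm n ≡ iterate D sgn n 0
Bpm≡iterate-D n = trans (partialB≡stirlingSum n n) (stirlingSum-diagonal n sgn)

module _ {n : ℕ} .{{_ : NonZero n}} where

  at : Vec ℕ n → ℕ → ℕ
  at v k = lookup v (k DivMod.mod n)

  at-cong : ∀ v {i j} → i % n ≡ j % n → at v i ≡ at v j
  at-cong v i%n≡j%n = cong (lookup v)
    (toℕ-injective (trans (toℕ-fromℕ< _) (trans i%n≡j%n (sym (toℕ-fromℕ< _)))))

  ReducesTo : (ℕ → ℤ) → Vec ℕ n → Set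
  ReducesTo w v = ∀ k → w k ≡ + at v k mod n

  ReducesTo-periodic : ∀ {w v} → (∀ k → w (n ℕ.+ k) ≡ w k mod n) →
                       (∀ {k} → k < n → w k ≡ + at v k mod n) → ReducesTo w v
  ReducesTo-periodic {w} {v} periodic initial k = ≡-mod-trans
    (subst (λ i → w i ≡ w (k % n) mod n)
      (sym (trans (m≡m%n+[m/n]*n k n) (+-comm (k % n) (k / n ℕ.* n))))
      (shift (k / n) (k % n)))
    (subst (λ i → w (k % n) ≡ + i mod n) (at-cong v (m%n%n≡m%n k n)) (initial (m%n<n k n)))
    where
    shift : ∀ q r → w (q ℕ.* n ℕ.+ r) ≡ w r mod n
    shift zero    r = ≡⇒≡-mod refl
    shift (suc q) r = ≡-mod-trans
      (subst (λ i → w i ≡ w (q ℕ.* n ℕ.+ r) mod n) (sym (+-assoc n (q ℕ.* n) r))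
        (periodic (q ℕ.* n ℕ.+ r)))
      (shift q r)

  reduceD : Vec ℕ n → Vec ℕ n
  reduceD v = tabulate λ i → (at v (suc (toℕ i)) ℕ.+ toℕ i ℕ.* lookup v i) % n

  suc-% : ∀ k → suc (k % n) % n ≡ suc k % n
  suc-% k = begin
    (1 ℕ.+ k % n) % n           ≡⟨ %-distribˡ-+ 1 (k % n) n ⟩
    (1 % n ℕ.+ k % n % n) % n   ≡⟨ cong (λ r → (1 % n ℕ.+ r) % n) (m%n%n≡m%n k n) ⟩
    (1 % n ℕ.+ k % n) % n       ≡⟨ %-distribˡ-+ 1 k n ⟨
    (1 ℕ.+ k) % n               ∎
    where open ≡-Reasoning

  at-reduceD : ∀ v k → at (reduceD v) k ≡ (at v (suc k) ℕ.+ k % n ℕ.* at v k) % n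
  at-reduceD v k = begin
    lookup (reduceD v) (k DivMod.mod n)
      ≡⟨ lookup∘tabulate _ (k DivMod.mod n) ⟩
    (at v (suc (toℕ (k DivMod.mod n))) ℕ.+ toℕ (k DivMod.mod n) ℕ.* at v k) % n
      ≡⟨ cong (λ i → (at v (suc i) ℕ.+ i ℕ.* at v k) % n) (toℕ-fromℕ< _) ⟩
    (at v (suc (k % n)) ℕ.+ k % n ℕ.* at v k) % n
      ≡⟨ cong (λ a → (a ℕ.+ k % n ℕ.* at v k) % n) (at-cong v (suc-% k)) ⟩
    (at v (suc k) ℕ.+ k % n ℕ.* at v k) % n ∎
    where open ≡-Reasoning

  ReducesTo-D : ∀ {w v} → ReducesTo w v → ReducesTo (D w) (reduceD v)
  ReducesTo-D {w} {v} w↦v k = begin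
    w (suc k) + + k * w k
      ≈⟨ +-cong-≡-mod (w↦v (suc k)) (*-cong-≡-mod (≡-mod-sym (%-≡-mod k n)) (w↦v k)) ⟩
    + at v (suc k) + + (k % n) * + at v k
      ≡⟨ cong (λ t → + at v (suc k) + t) (pos-* (k % n) (at v k)) ⟨
    + at v (suc k) + + (k % n ℕ.* at v k)
      ≡⟨ pos-+ (at v (suc k)) (k % n ℕ.* at v k) ⟨
    + (at v (suc k) ℕ.+ k % n ℕ.* at v k)
      ≈⟨ %-≡-mod _ n ⟨
    + ((at v (suc k) ℕ.+ k % n ℕ.* at v k) % n)
      ≡⟨ cong +_ (at-reduceD v k) ⟨
    + at (reduceD v) k ∎
    where open import Relation.Binary.Reasoning.Setoid (≡-mod-setoid n)

  ReducesTo-iterate : ∀ {w v} → ReducesTo w v →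
                      ∀ j → ReducesTo (iterate D w j) (iterate reduceD v j)
  ReducesTo-iterate         w↦v zero    = w↦v
  ReducesTo-iterate {w} {v} w↦v (suc j) = ReducesTo-iterate (ReducesTo-D {w} {v} w↦v) j

module _ {A : Set} (f : A → A) where

  iterate-+ : ∀ x m k → iterate f x (m ℕ.+ k) ≡ iterate f (iterate f x m) k
  iterate-+ x zero    k = refl
  iterate-+ x (suc m) k = iterate-+ (f x) m k

  iterate-periodic : ∀ {x p} .{{_ : NonZero p}} → iterate f x p ≡ x →
                     ∀ j → iterate f x j ≡ iterate f x (j % p)
  iterate-periodic {x} {p} fᵖx≡x j = begin
    iterate f x j
      ≡⟨ cong (iterate f x) j≡qp+r ⟩
    iterate f x (j / p ℕ.* p ℕ.+ j % p)
      ≡⟨ iterate-+ x (j / p ℕ.* p) (j % p) ⟩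
    iterate f (iterate f x (j / p ℕ.* p)) (j % p)
      ≡⟨ cong (λ y → iterate f y (j % p)) (multiple (j / p)) ⟩
    iterate f x (j % p) ∎
    where
    open ≡-Reasoning
    j≡qp+r : j ≡ j / p ℕ.* p ℕ.+ j % p
    j≡qp+r = trans (m≡m%n+[m/n]*n j p) (+-comm (j % p) (j / p ℕ.* p))
    multiple : ∀ q → iterate f x (q ℕ.* p) ≡ x
    multiple zero    = refl
    multiple (suc q) = trans (iterate-+ x p (q ℕ.* p))
                             (trans (cong (λ y → iterate f y (q ℕ.* p)) fᵖx≡x) (multiple q))

signsMod8 : Vec ℕ 8
signsMod8 = 1 ∷ 7 ∷ 1 ∷ 7 ∷ 1 ∷ 7 ∷ 1 ∷ 7 ∷ []

sgn-+2 : ∀ k → sgn (2 ℕ.+ k) ≡ sgn k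
sgn-+2 k = neg-involutive (sgn k)

sgn-ReducesTo : ReducesTo sgn signsMod8
sgn-ReducesTo = ReducesTo-periodic {w = sgn} {v = signsMod8}
  (λ k → ≡⇒≡-mod (trans (sgn-+2 (6 ℕ.+ k))
    (trans (sgn-+2 (4 ℕ.+ k)) (trans (sgn-+2 (2 ℕ.+ k)) (sgn-+2 k)))))
  (toWitness {a? = allUpTo? (λ k → sgn k ≟ + at signsMod8 k mod 8) 8} _)

-- Decided rather than proved by refl: the conversion checker does not share the
-- intermediate vectors and runs out of memory.
reduceD-period : iterate reduceD signsMod8 24 ≡ signsMod8
reduceD-period = toWitness {a? = ≡-dec ℕ._≟_ (iterate reduceD signsMod8 24) signsMod8} _

bpmMod8 : ℕ → ℕ
bpmMod8 j = at (iterate reduceD signsMod8 j) 0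

Bpm≡bpmMod8 : ∀ j → Bpm j ≡ + bpmMod8 (j % 24) mod 8
Bpm≡bpmMod8 j = begin
  Bpm j
    ≡⟨ Bpm≡iterate-D j ⟩
  iterate D sgn j 0
    ≈⟨ ReducesTo-iterate {w = sgn} {v = signsMod8} sgn-ReducesTo j 0 ⟩
  + at (iterate reduceD signsMod8 j) 0
    ≡⟨ cong (λ v → + at v 0) (iterate-periodic reduceD {signsMod8} {24} reduceD-period j) ⟩
  + bpmMod8 (j % 24) ∎
  where open import Relation.Binary.Reasoning.Setoid (≡-mod-setoid 8)

-- The arguments a and b stand for j mod 3 and j mod 12.
ν₂-pattern : ℕ → ℕ → ℤ → Set
ν₂-pattern a b x =
  ((a ≡ 0 ⊎ a ≡ 1) → ν₂≡ x 0) × ((b ≡ 5 ⊎ b ≡ 8) → ν₂≡ x 1) × (b ≡ 11 → ν₂≡ x 2)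

ν₂-pattern? : ∀ a b v → Dec (ν₂-pattern a b (+ v))
ν₂-pattern? a b v =
  (((a ℕ.≟ 0) ⊎-dec (a ℕ.≟ 1)) →-dec ν₂≡? 0) ×-dec
  (((b ℕ.≟ 5) ⊎-dec (b ℕ.≟ 8)) →-dec ν₂≡? 1) ×-dec
  ((b ℕ.≟ 11) →-dec ν₂≡? 2)
  where
  ν₂≡? : ∀ e → Dec (ν₂≡ (+ v) e)
  ν₂≡? e = (2 ^ e ∣? v) ×-dec ¬? (2 ^ suc e ∣? v)

ν₂-pattern-resp-≡-mod : ∀ {a b x y} → x ≡ y mod 8 → ν₂-pattern a b x → ν₂-pattern a b y
ν₂-pattern-resp-≡-mod x≡y (ν₀ , ν₁ , ν₂) =
  (λ h → ν₂≡-resp-≡-mod {e = 0} (divides 4 refl) x≡y (ν₀ h)) ,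
  (λ h → ν₂≡-resp-≡-mod {e = 1} (divides 2 refl) x≡y (ν₁ h)) ,
  (λ h → ν₂≡-resp-≡-mod {e = 2} (divides 1 refl) x≡y (ν₂ h))

ν₂-pattern-%24 : ∀ j {x} → ν₂-pattern (j % 24 % 3) (j % 24 % 12) x →
                 ν₂-pattern (j % 3) (j % 12) x
ν₂-pattern-%24 j {x} = subst₂ (λ a b → ν₂-pattern a b x)
  (m∣n⇒o%n%m≡o%m 3 24 j (divides 8 refl)) (m∣n⇒o%n%m≡o%m 12 24 j (divides 2 refl))

ν₂-pattern-bpmMod8 : ∀ {r} → r < 24 → ν₂-pattern (r % 3) (r % 12) (+ bpmMod8 r)
ν₂-pattern-bpmMod8 =
  toWitness {a? = allUpTo? (λ r → ν₂-pattern? (r % 3) (r % 12) (bpmMod8 r)) 24} _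

corollary6p3 : (j : ℕ) →
    ((j % 3 ≡ 0 ⊎ j % 3 ≡ 1) → ν₂≡ (Bpm j) 0) ×
    ((j % 12 ≡ 5 ⊎ j % 12 ≡ 8) → ν₂≡ (Bpm j) 1) ×
    (j % 12 ≡ 11 → ν₂≡ (Bpm j) 2)
corollary6p3 j = ν₂-pattern-resp-≡-mod (≡-mod-sym (Bpm≡bpmMod8 j)) residue-pattern
  where
  residue-pattern : ν₂-pattern (j % 3) (j % 12) (+ bpmMod8 (j % 24))
  residue-pattern = ν₂-pattern-%24 j {+ bpmMod8 (j % 24)} (ν₂-pattern-bpmMod8 (m%n<n j 24))
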